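{- Let $k\in\mathbb{N}$ and $S=\langle 4k+7,4k+9,4k+13,4k+15\rangle$. Then \[\mathrm{Ap}(S,4k+7)=\{a(4k+9)+b(4k+13)+c(4k+15)\mid (a,b,c)\in C\},\] where $C=C_a\cup C_b\cup C_c$ with $C_a=\big(\{1\}\times\{0\}\times\{0,1,\dots,k+1\}\big)\cup\{(2,0,0)\}$, $C_b=\{0\}\times\{1,2\}\times\{0,1,\dots,k\}$, and $C_c=\{0\}\times\{0\}\times\{0,1,\dots,k+1\}$.
   Context: $\mathbb{N}=\{0,1,2,\dots\}$. For $X\subseteq\mathbb{N}$, $\langle X\rangle$ is the submonoid of $(\mathbb{N},+)$ generated by $X$; here it is a numerical semigroup. For a numerical semigroup $S$ and $n\in S\setminus\{0\}$, the Apéry set is $\mathrm{Ap}(S,n)=\{s\in S\mid s-n\notin S\}$. -}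

module Defs where

open import Data.Nat using (ℕ; zero; suc; _+_; _*_; _≤_; _∸_)
open import Data.Vec using (Vec; []; _∷_)
open import Data.Product using (Σ; _×_; ∃-syntax)
open import Data.Sum using (_⊎_)
open import Relation.Binary.PropositionalEquality using (_≡_)
open import Relation.Nullary using (¬_)

lincomb : ∀ {n} → Vec ℕ n → Vec ℕ n → ℕ
lincomb [] [] = 0
lincomb (c ∷ cs) (g ∷ gs) = c * g + lincomb cs gs

InMonoid : ∀ {n} → Vec ℕ n → ℕ → Set
InMonoid {n} gens x = Σ (Vec ℕ n) λ cs → lincomb cs gens ≡ x

-- Apéry set Ap(S, m) = { s ∈ S | s - m ∉ S }, with S = ⟨ gens ⟩.
-- "s - m ∉ S" means: there is no t ∈ S with t + m = s (integer subtraction).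
InApery : ∀ {n} → Vec ℕ n → ℕ → ℕ → Set
InApery gens m s = InMonoid gens s × ¬ (Σ ℕ λ t → InMonoid gens t × t + m ≡ s)

gensS : ℕ → Vec ℕ 4
gensS k = (4 * k + 7) ∷ (4 * k + 9) ∷ (4 * k + 13) ∷ (4 * k + 15) ∷ []

Ca : ℕ → ℕ → ℕ → ℕ → Set
Ca k a b c = (a ≡ 1 × b ≡ 0 × c ≤ k + 1) ⊎ (a ≡ 2 × b ≡ 0 × c ≡ 0)

Cb : ℕ → ℕ → ℕ → ℕ → Set
Cb k a b c = a ≡ 0 × (b ≡ 1 ⊎ b ≡ 2) × c ≤ k

Cc : ℕ → ℕ → ℕ → ℕ → Set
Cc k a b c = a ≡ 0 × b ≡ 0 × c ≤ k + 1

C : ℕ → ℕ → ℕ → ℕ → Set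
C k a b c = Ca k a b c ⊎ Cb k a b c ⊎ Cc k a b c

-- Write m = 4k+7, so that the other generators are g₁ = m+2, g₂ = m+6, g₃ = m+8.
-- The element w = a g₁ + b g₂ + c g₃ of a triple (a, b, c) ∈ C is congruent
-- to twice its label ρ modulo m, and the labels run exactly once through
-- 0, …, m−1; as 2 is invertible modulo the odd m, the m elements are pairwise
-- incongruent. Adding a generator to an element gives another element plus a
-- multiple of m (by the relations g₁+g₂ = g₃+m, 2g₁+g₃ = 2g₂+m, 3g₁ = g₂+2m,
-- 3g₂ = g₁+2g₃ and the wrap-around identities), so every s ∈ S is an element
-- plus a multiple of m. A family in S containing 0 with these two properties
-- is the Apéry set.
module Submission where

open import Defs
open import Data.Nat using (ℕ; zero; suc; _+_; _*_; _≤_; _<_; z≤n; s≤s; s≤s⁻¹; z<s; _%_; NonZero; >-nonZero; ≢-nonZero⁻¹)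
open import Data.Nat.Properties
open import Data.Nat.DivMod using ([m+kn]%n≡m%n; m<n⇒m%n≡m; %-distribˡ-*)
open import Data.Nat.Tactic.RingSolver using (solve-∀)
open import Data.Product using (Σ; _×_; _,_; proj₁)
open import Data.Product.Properties using (×-≡,≡→≡)
open import Data.Sum using (inj₁; inj₂)
open import Data.Vec using (Vec; []; _∷_)
open import Data.Vec.Relation.Unary.All using (All; []; _∷_)
open import Data.Empty using (⊥-elim)
open import Relation.Binary.PropositionalEquality using (_≡_; _≢_; refl; sym; trans; cong; subst; module ≡-Reasoning)
open import Function using (_∘_)
open import Function.Bundles using (_⇔_; mk⇔)
open import Function.Construct.Composition using (_⇔-∘_)

remainder-quotient-unique : ∀ d .{{_ : NonZero d}} {h q h′ q′} →
  h < d → h′ < d → h + q * d ≡ h′ + q′ * d → h ≡ h′ × q ≡ q′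
remainder-quotient-unique d {h} {q} {h′} {q′} h<d h′<d eq = h≡h′ , q≡q′
  where
  open ≡-Reasoning
  h≡h′ : h ≡ h′
  h≡h′ = begin
    h                 ≡⟨ m<n⇒m%n≡m h<d ⟨
    h % d             ≡⟨ [m+kn]%n≡m%n h q d ⟨
    (h + q * d) % d   ≡⟨ cong (_% d) eq ⟩
    (h′ + q′ * d) % d ≡⟨ [m+kn]%n≡m%n h′ q′ d ⟩
    h′ % d            ≡⟨ m<n⇒m%n≡m h′<d ⟩
    h′                ∎
  q≡q′ : q ≡ q′
  q≡q′ = *-cancelʳ-≡ q q′ d (+-cancelˡ-≡ h (q * d) (q′ * d) (trans eq (cong (_+ q′ * d) (sym h≡h′))))

%-cong-*ʳ : ∀ {x y} d u .{{_ : NonZero d}} → x % d ≡ y % d → (x * u) % d ≡ (y * u) % d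
%-cong-*ʳ {x} {y} d u eq = begin
  (x * u) % d                 ≡⟨ %-distribˡ-* x u d ⟩
  ((x % d) * (u % d)) % d     ≡⟨ cong (λ r → (r * (u % d)) % d) eq ⟩
  ((y % d) * (u % d)) % d     ≡⟨ %-distribˡ-* y u d ⟨
  (y * u) % d                 ∎
  where open ≡-Reasoning

module AperyCriterion (m : ℕ) .{{_ : NonZero m}} {I : Set} (w : I → ℕ) where

  Above : ℕ → Set
  Above s = Σ I λ i → Σ ℕ λ j → w i + j * m ≡ s

  ClosedUnder : ℕ → Set
  ClosedUnder g = ∀ i → Above (w i + g)

  Incongruent : Set
  Incongruent = ∀ i i′ → w i % m ≡ w i′ % m → w i ≡ w i′

  private
    +-suc-* : ∀ x j n → x + j * n + n ≡ x + suc j * n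
    +-suc-* = solve-∀

  above-+ : ∀ {g s} → ClosedUnder g → Above s → Above (s + g)
  above-+ {g} closed (i , j , refl) with closed i
  ... | i′ , j′ , eq = i′ , j′ + j , (begin
    w i′ + (j′ + j) * m     ≡⟨ cong (w i′ +_) (*-distribʳ-+ m j′ j) ⟩
    w i′ + (j′ * m + j * m) ≡⟨ +-assoc (w i′) (j′ * m) (j * m) ⟨
    w i′ + j′ * m + j * m   ≡⟨ cong (_+ j * m) eq ⟩
    w i + g + j * m         ≡⟨ +-*-shift (w i) g j m ⟩
    w i + j * m + g         ∎)
    where
    open ≡-Reasoning
    +-*-shift : ∀ x y j n → x + y + j * n ≡ x + j * n + y
    +-*-shift = solve-∀

  above-*+ : ∀ {g s} → ClosedUnder g → ∀ c → Above s → Above (c * g + s)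
  above-*+ closed zero    above = above
  above-*+ {g} {s} closed (suc c) above =
    subst Above (trans (+-comm (c * g + s) g) (sym (+-assoc g (c * g) s)))
      (above-+ closed (above-*+ closed c above))

  above-lincomb : ∀ {n} {gs : Vec ℕ n} →
    Above 0 → All ClosedUnder gs → ∀ cs → Above (lincomb cs gs)
  above-lincomb above₀ []                 []       = above₀
  above-lincomb above₀ (closed ∷ closeds) (c ∷ cs) = above-*+ closed c (above-lincomb above₀ closeds cs)

  above-+m* : ∀ {s} c → Above s → Above (c * m + s)
  above-+m* c (i , j , refl) = i , j + c , solve-shift (w i) j c m
    where
    solve-shift : ∀ x j c n → x + (j + c) * n ≡ c * n + (x + j * n)
    solve-shift = solve-∀

  above-monoid : ∀ {n} {gs : Vec ℕ n} {s} →
    Above 0 → All ClosedUnder gs → InMonoid (m ∷ gs) s → Above s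
  above-monoid above₀ closeds (c ∷ cs , refl) = above-+m* c (above-lincomb above₀ closeds cs)

  ∈-+* : ∀ {n} {gs : Vec ℕ n} {x} → InMonoid (m ∷ gs) x → ∀ j → InMonoid (m ∷ gs) (x + j * m)
  ∈-+* {gs = gs} (c ∷ cs , refl) j = j + c ∷ cs , regroup j c m (lincomb cs gs)
    where
    regroup : ∀ j c n l → (j + c) * n + l ≡ c * n + l + j * n
    regroup = solve-∀

  incongruent-no-shift : Incongruent → ∀ i i′ j → w i ≢ w i′ + suc j * m
  incongruent-no-shift incongruent i i′ j eq =
    ≢-nonZero⁻¹ m (m+n≡0⇒m≡0 m (+-cancelˡ-≡ (w i′) (suc j * m) 0 shift≡0))
    where
    same : w i ≡ w i′
    same = incongruent i i′ (trans (cong (_% m) eq) ([m+kn]%n≡m%n (w i′) (suc j) m))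
    shift≡0 : w i′ + suc j * m ≡ w i′ + 0
    shift≡0 = trans (sym eq) (trans same (sym (+-identityʳ (w i′))))

  apery-criterion : ∀ {n} {gs : Vec ℕ n} →
    (∀ i → InMonoid (m ∷ gs) (w i)) → Σ I (λ i → w i ≡ 0) → All ClosedUnder gs → Incongruent →
    ∀ s → InApery (m ∷ gs) m s ⇔ Σ I (λ i → w i ≡ s)
  apery-criterion {gs = gs} w∈S (i₀ , w≡0) closeds incongruent s = mk⇔ to from
    where
    above₀ : Above 0
    above₀ = i₀ , 0 , trans (+-identityʳ (w i₀)) w≡0

    to : InApery (m ∷ gs) m s → Σ I (λ i → w i ≡ s)
    to (s∈S , s-m∉S) with above-monoid above₀ closeds s∈S
    ... | i , zero  , eq = i , trans (sym (+-identityʳ (w i))) eq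
    ... | i , suc j , eq = ⊥-elim (s-m∉S (w i + j * m , ∈-+* (w∈S i) j , trans (+-suc-* (w i) j m) eq))

    from : Σ I (λ i → w i ≡ s) → InApery (m ∷ gs) m s
    from (i , refl) = w∈S i , λ where
      (t , t∈S , t+m≡s) → let (i′ , j , eq) = above-monoid above₀ closeds t∈S in
        incongruent-no-shift incongruent i i′ j
          (trans (sym t+m≡s) (trans (cong (_+ m) (sym eq)) (+-suc-* (w i′) j m)))

data Triple (k : ℕ) : Set where
  ⟨0,0,_⟩ : (c : ℕ) → c ≤ suc k → Triple k
  ⟨1,0,_⟩ : (c : ℕ) → c ≤ suc k → Triple k
  ⟨2,0,0⟩ : Triple k
  ⟨0,1,_⟩ : (c : ℕ) → c ≤ k → Triple k
  ⟨0,2,_⟩ : (c : ℕ) → c ≤ k → Triple k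

-- A triple is encoded by the base-4 digits (h , q) of its label h + 4q, and its
-- element is computed from the digits, so that equal labels give equal elements.
digits : ∀ {k} → Triple k → ℕ × ℕ
digits (⟨0,0, c ⟩ _) = 0 , c
digits (⟨1,0, c ⟩ _) = 1 , c
digits ⟨2,0,0⟩       = 2 , 0
digits (⟨0,1, c ⟩ _) = 3 , c
digits (⟨0,2, c ⟩ _) = 2 , suc c

coefficients : ℕ × ℕ → ℕ × ℕ × ℕ
coefficients (0 , q)     = 0 , 0 , q
coefficients (1 , q)     = 1 , 0 , q
coefficients (2 , zero)  = 2 , 0 , 0
coefficients (2 , suc q) = 0 , 2 , q
coefficients (3 , q)     = 0 , 1 , q
coefficients _           = 0 , 0 , 0   -- h ≥ 4 does not occur

combination : ℕ → ℕ × ℕ × ℕ → ℕ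
combination k (a , b , c) = a * (4 * k + 9) + b * (4 * k + 13) + c * (4 * k + 15)

element : ∀ {k} → Triple k → ℕ
element {k} e = combination k (coefficients (digits e))

label : ∀ {k} → Triple k → ℕ
label e = let (h , q) = digits e in h + q * 4

digits-mono : ∀ {h q d n} → h ≤ d → q ≤ n → h + q * 4 ≤ d + n * 4
digits-mono h≤d q≤n = +-mono-≤ h≤d (*-monoˡ-≤ 4 q≤n)

element-∈S : ∀ {k} (e : Triple k) → InMonoid (gensS k) (element e)
element-∈S {k} e = let (a , b , c) = coefficients (digits e) in
  0 ∷ a ∷ b ∷ c ∷ [] , regroup k a b c
  where
  regroup : ∀ k a b c → a * (4 * k + 9) + (b * (4 * k + 13) + (c * (4 * k + 15) + 0))
                        ≡ a * (4 * k + 9) + b * (4 * k + 13) + c * (4 * k + 15)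
  regroup = solve-∀

-- In the names below, m, g₁, g₂, g₃ stand for 4k+7, 4k+9, 4k+13, 4k+15.
absorb-g₁ : ∀ k a b c →
  suc a * (4 * k + 9) + b * (4 * k + 13) + c * (4 * k + 15) + 0 * (4 * k + 7)
    ≡ a * (4 * k + 9) + b * (4 * k + 13) + c * (4 * k + 15) + (4 * k + 9)
absorb-g₁ = solve-∀

absorb-g₂ : ∀ k a b c →
  a * (4 * k + 9) + suc b * (4 * k + 13) + c * (4 * k + 15) + 0 * (4 * k + 7)
    ≡ a * (4 * k + 9) + b * (4 * k + 13) + c * (4 * k + 15) + (4 * k + 13)
absorb-g₂ = solve-∀

absorb-g₃ : ∀ k a b c →
  a * (4 * k + 9) + b * (4 * k + 13) + suc c * (4 * k + 15) + 0 * (4 * k + 7)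
    ≡ a * (4 * k + 9) + b * (4 * k + 13) + c * (4 * k + 15) + (4 * k + 15)
absorb-g₃ = solve-∀

g₂+g₁≡g₃+m : ∀ k a b c →
  a * (4 * k + 9) + b * (4 * k + 13) + suc c * (4 * k + 15) + 1 * (4 * k + 7)
    ≡ a * (4 * k + 9) + suc b * (4 * k + 13) + c * (4 * k + 15) + (4 * k + 9)
g₂+g₁≡g₃+m = solve-∀

g₁+g₂≡g₃+m : ∀ k a b c →
  a * (4 * k + 9) + b * (4 * k + 13) + suc c * (4 * k + 15) + 1 * (4 * k + 7)
    ≡ suc a * (4 * k + 9) + b * (4 * k + 13) + c * (4 * k + 15) + (4 * k + 13)
g₁+g₂≡g₃+m = solve-∀

g₁+g₃+g₁≡2g₂+m : ∀ k a b c →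
  a * (4 * k + 9) + (2 + b) * (4 * k + 13) + c * (4 * k + 15) + 1 * (4 * k + 7)
    ≡ suc a * (4 * k + 9) + b * (4 * k + 13) + suc c * (4 * k + 15) + (4 * k + 9)
g₁+g₃+g₁≡2g₂+m = solve-∀

2g₁+g₃≡2g₂+m : ∀ k a b c →
  a * (4 * k + 9) + (2 + b) * (4 * k + 13) + c * (4 * k + 15) + 1 * (4 * k + 7)
    ≡ (2 + a) * (4 * k + 9) + b * (4 * k + 13) + c * (4 * k + 15) + (4 * k + 15)
2g₁+g₃≡2g₂+m = solve-∀

3g₁≡g₂+2m : ∀ k a b c →
  a * (4 * k + 9) + suc b * (4 * k + 13) + c * (4 * k + 15) + 2 * (4 * k + 7)
    ≡ (2 + a) * (4 * k + 9) + b * (4 * k + 13) + c * (4 * k + 15) + (4 * k + 9)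
3g₁≡g₂+2m = solve-∀

3g₂≡g₁+2g₃ : ∀ k a b c →
  suc a * (4 * k + 9) + b * (4 * k + 13) + (2 + c) * (4 * k + 15) + 0 * (4 * k + 7)
    ≡ a * (4 * k + 9) + (2 + b) * (4 * k + 13) + c * (4 * k + 15) + (4 * k + 13)
3g₂≡g₁+2g₃ = solve-∀

2g₂+kg₃+g₁≡[k+5]m : ∀ k →
  0 * (4 * k + 9) + 0 * (4 * k + 13) + 0 * (4 * k + 15) + (k + 5) * (4 * k + 7)
    ≡ 0 * (4 * k + 9) + 2 * (4 * k + 13) + k * (4 * k + 15) + (4 * k + 9)
2g₂+kg₃+g₁≡[k+5]m = solve-∀

[k+1]g₃+g₂≡[k+4]m : ∀ k a →
  a * (4 * k + 9) + 0 * (4 * k + 13) + 0 * (4 * k + 15) + (k + 4) * (4 * k + 7)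
    ≡ a * (4 * k + 9) + 0 * (4 * k + 13) + suc k * (4 * k + 15) + (4 * k + 13)
[k+1]g₃+g₂≡[k+4]m = solve-∀

3g₂+kg₃≡2g₁+[k+3]m : ∀ k →
  2 * (4 * k + 9) + 0 * (4 * k + 13) + 0 * (4 * k + 15) + (k + 3) * (4 * k + 7)
    ≡ 0 * (4 * k + 9) + 2 * (4 * k + 13) + k * (4 * k + 15) + (4 * k + 13)
3g₂+kg₃≡2g₁+[k+3]m = solve-∀

[k+2]g₃≡g₁+[k+3]m : ∀ k a →
  suc a * (4 * k + 9) + 0 * (4 * k + 13) + 0 * (4 * k + 15) + (k + 3) * (4 * k + 7)
    ≡ a * (4 * k + 9) + 0 * (4 * k + 13) + suc k * (4 * k + 15) + (4 * k + 15)
[k+2]g₃≡g₁+[k+3]m = solve-∀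

g₂+[k+1]g₃≡[k+4]m : ∀ k b →
  0 * (4 * k + 9) + b * (4 * k + 13) + 0 * (4 * k + 15) + (k + 4) * (4 * k + 7)
    ≡ 0 * (4 * k + 9) + suc b * (4 * k + 13) + k * (4 * k + 15) + (4 * k + 15)
g₂+[k+1]g₃≡[k+4]m = solve-∀

module _ {k : ℕ} where
  instance
    nonZero-4k+7 : NonZero (4 * k + 7)
    nonZero-4k+7 = >-nonZero (<-≤-trans z<s (m≤n+m 7 (4 * k)))

  open AperyCriterion (4 * k + 7) (element {k})

  -- Adding g₁, g₂, g₃ raises the label by 1, 3, 4 modulo m; each clause moves to
  -- the triple carrying the new label.
  closed-g₁ : ClosedUnder (4 * k + 9)
  closed-g₁ (⟨0,0, c ⟩ p)     = ⟨1,0, c ⟩ p , 0 , absorb-g₁ k 0 0 c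
  closed-g₁ (⟨1,0, zero ⟩ _)  = ⟨2,0,0⟩ , 0 , absorb-g₁ k 1 0 0
  closed-g₁ (⟨1,0, suc c ⟩ p) = ⟨0,2, c ⟩ (s≤s⁻¹ p) , 1 , g₁+g₃+g₁≡2g₂+m k 0 0 c
  closed-g₁ ⟨2,0,0⟩           = ⟨0,1, 0 ⟩ z≤n , 2 , 3g₁≡g₂+2m k 0 0 0
  closed-g₁ (⟨0,1, c ⟩ p)     = ⟨0,0, suc c ⟩ (s≤s p) , 1 , g₂+g₁≡g₃+m k 0 0 c
  closed-g₁ (⟨0,2, c ⟩ p) with m≤n⇒m<n∨m≡n p
  ... | inj₁ c<k  = ⟨0,1, suc c ⟩ c<k , 1 , g₂+g₁≡g₃+m k 0 1 c
  ... | inj₂ refl = ⟨0,0, 0 ⟩ z≤n , k + 5 , 2g₂+kg₃+g₁≡[k+5]m k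

  closed-g₂ : ClosedUnder (4 * k + 13)
  closed-g₂ (⟨0,0, c ⟩ p) with m≤n⇒m<n∨m≡n p
  ... | inj₁ c<k+1 = ⟨0,1, c ⟩ (s≤s⁻¹ c<k+1) , 0 , absorb-g₂ k 0 0 c
  ... | inj₂ refl  = ⟨0,0, 0 ⟩ z≤n , k + 4 , [k+1]g₃+g₂≡[k+4]m k 0
  closed-g₂ (⟨1,0, c ⟩ p) with m≤n⇒m<n∨m≡n p
  ... | inj₁ c<k+1 = ⟨0,0, suc c ⟩ c<k+1 , 1 , g₁+g₂≡g₃+m k 0 0 c
  ... | inj₂ refl  = ⟨1,0, 0 ⟩ z≤n , k + 4 , [k+1]g₃+g₂≡[k+4]m k 1
  closed-g₂ ⟨2,0,0⟩ = ⟨1,0, 1 ⟩ (s≤s z≤n) , 1 , g₁+g₂≡g₃+m k 1 0 0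
  closed-g₂ (⟨0,1, c ⟩ p) = ⟨0,2, c ⟩ p , 0 , absorb-g₂ k 0 1 c
  closed-g₂ (⟨0,2, c ⟩ p) with m≤n⇒m<n∨m≡n p
  ... | inj₁ c<k  = ⟨1,0, 2 + c ⟩ (s≤s c<k) , 0 , 3g₂≡g₁+2g₃ k 0 0 c
  ... | inj₂ refl = ⟨2,0,0⟩ , k + 3 , 3g₂+kg₃≡2g₁+[k+3]m k

  closed-g₃ : ClosedUnder (4 * k + 15)
  closed-g₃ (⟨0,0, c ⟩ p) with m≤n⇒m<n∨m≡n p
  ... | inj₁ c<k+1 = ⟨0,0, suc c ⟩ c<k+1 , 0 , absorb-g₃ k 0 0 c
  ... | inj₂ refl  = ⟨1,0, 0 ⟩ z≤n , k + 3 , [k+2]g₃≡g₁+[k+3]m k 0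
  closed-g₃ (⟨1,0, c ⟩ p) with m≤n⇒m<n∨m≡n p
  ... | inj₁ c<k+1 = ⟨1,0, suc c ⟩ c<k+1 , 0 , absorb-g₃ k 1 0 c
  ... | inj₂ refl  = ⟨2,0,0⟩ , k + 3 , [k+2]g₃≡g₁+[k+3]m k 1
  closed-g₃ ⟨2,0,0⟩ = ⟨0,2, 0 ⟩ z≤n , 1 , 2g₁+g₃≡2g₂+m k 0 0 0
  closed-g₃ (⟨0,1, c ⟩ p) with m≤n⇒m<n∨m≡n p
  ... | inj₁ c<k  = ⟨0,1, suc c ⟩ c<k , 0 , absorb-g₃ k 0 1 c
  ... | inj₂ refl = ⟨0,0, 0 ⟩ z≤n , k + 4 , g₂+[k+1]g₃≡[k+4]m k 0
  closed-g₃ (⟨0,2, c ⟩ p) with m≤n⇒m<n∨m≡n p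
  ... | inj₁ c<k  = ⟨0,2, suc c ⟩ c<k , 0 , absorb-g₃ k 0 2 c
  ... | inj₂ refl = ⟨0,1, 0 ⟩ z≤n , k + 4 , g₂+[k+1]g₃≡[k+4]m k 1

  -- 2k + 4 is the inverse of 2 modulo 4k + 7.
  [αm+2r][2k+4]%m≡r : ∀ α r → r < 4 * k + 7 →
    ((α * (4 * k + 7) + 2 * r) * (2 * k + 4)) % (4 * k + 7) ≡ r
  [αm+2r][2k+4]%m≡r α r r<m = begin
    ((α * (4 * k + 7) + 2 * r) * (2 * k + 4)) % (4 * k + 7) ≡⟨ cong (_% (4 * k + 7)) (regroup k α r) ⟩
    (r + (α * (2 * k + 4) + r) * (4 * k + 7)) % (4 * k + 7) ≡⟨ [m+kn]%n≡m%n r (α * (2 * k + 4) + r) (4 * k + 7) ⟩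
    r % (4 * k + 7)                                         ≡⟨ m<n⇒m%n≡m r<m ⟩
    r                                                       ∎
    where
    open ≡-Reasoning
    regroup : ∀ k α r →
      (α * (4 * k + 7) + 2 * r) * (2 * k + 4) ≡ r + (α * (2 * k + 4) + r) * (4 * k + 7)
    regroup = solve-∀

  element-decomposition : ∀ (e : Triple k) → Σ ℕ λ α → element e ≡ α * (4 * k + 7) + 2 * label e
  element-decomposition (⟨0,0, c ⟩ _) = c , split k c
    where
    split : ∀ k c → 0 * (4 * k + 9) + 0 * (4 * k + 13) + c * (4 * k + 15)
                    ≡ c * (4 * k + 7) + 2 * (0 + c * 4)
    split = solve-∀
  element-decomposition (⟨1,0, c ⟩ _) = suc c , split k c
    where
    split : ∀ k c → 1 * (4 * k + 9) + 0 * (4 * k + 13) + c * (4 * k + 15)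
                    ≡ suc c * (4 * k + 7) + 2 * (1 + c * 4)
    split = solve-∀
  element-decomposition ⟨2,0,0⟩ = 2 , split k
    where
    split : ∀ k → 2 * (4 * k + 9) + 0 * (4 * k + 13) + 0 * (4 * k + 15)
                  ≡ 2 * (4 * k + 7) + 2 * (2 + 0 * 4)
    split = solve-∀
  element-decomposition (⟨0,1, c ⟩ _) = suc c , split k c
    where
    split : ∀ k c → 0 * (4 * k + 9) + 1 * (4 * k + 13) + c * (4 * k + 15)
                    ≡ suc c * (4 * k + 7) + 2 * (3 + c * 4)
    split = solve-∀
  element-decomposition (⟨0,2, c ⟩ _) = 2 + c , split k c
    where
    split : ∀ k c → 0 * (4 * k + 9) + 2 * (4 * k + 13) + c * (4 * k + 15)
                    ≡ (2 + c) * (4 * k + 7) + 2 * (2 + suc c * 4)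
    split = solve-∀

  label≤ : ∀ (e : Triple k) → label e ≤ 6 + k * 4
  label≤ (⟨0,0, c ⟩ c≤k+1) = digits-mono {d = 2} z≤n c≤k+1
  label≤ (⟨1,0, c ⟩ c≤k+1) = digits-mono {d = 2} (s≤s z≤n) c≤k+1
  label≤ ⟨2,0,0⟩           = digits-mono {n = suc k} ≤-refl z≤n
  label≤ (⟨0,1, c ⟩ c≤k)   = digits-mono {d = 6} (s≤s (s≤s (s≤s z≤n))) c≤k
  label≤ (⟨0,2, c ⟩ c≤k)   = digits-mono {h = 6} ≤-refl c≤k

  label<m : ∀ (e : Triple k) → label e < 4 * k + 7
  label<m e = ≤-trans (s≤s (label≤ e)) (≤-reflexive (reorder k))
    where
    reorder : ∀ k → suc (6 + k * 4) ≡ 4 * k + 7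
    reorder = solve-∀

  digit<4 : ∀ (e : Triple k) → proj₁ (digits e) < 4
  digit<4 (⟨0,0, _ ⟩ _) = s≤s z≤n
  digit<4 (⟨1,0, _ ⟩ _) = s≤s (s≤s z≤n)
  digit<4 ⟨2,0,0⟩       = s≤s (s≤s (s≤s z≤n))
  digit<4 (⟨0,1, _ ⟩ _) = s≤s (s≤s (s≤s (s≤s z≤n)))
  digit<4 (⟨0,2, _ ⟩ _) = s≤s (s≤s (s≤s z≤n))

  label≡element*[2k+4]%m : ∀ (e : Triple k) → (element e * (2 * k + 4)) % (4 * k + 7) ≡ label e
  label≡element*[2k+4]%m e = let (α , eq) = element-decomposition e in
    trans (cong (λ x → (x * (2 * k + 4)) % (4 * k + 7)) eq) ([αm+2r][2k+4]%m≡r α (label e) (label<m e))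

  element-incongruent : Incongruent
  element-incongruent e e′ eq = cong (combination k ∘ coefficients)
    (×-≡,≡→≡ (remainder-quotient-unique 4 (digit<4 e) (digit<4 e′) same-label))
    where
    same-label : label e ≡ label e′
    same-label = trans (sym (label≡element*[2k+4]%m e))
                   (trans (%-cong-*ʳ (4 * k + 7) (2 * k + 4) eq) (label≡element*[2k+4]%m e′))

  ≤1+k⇒≤k+1 : ∀ {c} → c ≤ suc k → c ≤ k + 1
  ≤1+k⇒≤k+1 {c} = subst (c ≤_) (+-comm 1 k)

  ≤k+1⇒≤1+k : ∀ {c} → c ≤ k + 1 → c ≤ suc k
  ≤k+1⇒≤1+k {c} = subst (c ≤_) (+-comm k 1)

  triple-∈C : ∀ (e : Triple k) → let (a , b , c) = coefficients (digits e) in C k a b c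
  triple-∈C (⟨0,0, c ⟩ c≤k+1) = inj₂ (inj₂ (refl , refl , ≤1+k⇒≤k+1 c≤k+1))
  triple-∈C (⟨1,0, c ⟩ c≤k+1) = inj₁ (inj₁ (refl , refl , ≤1+k⇒≤k+1 c≤k+1))
  triple-∈C ⟨2,0,0⟩           = inj₁ (inj₂ (refl , refl , refl))
  triple-∈C (⟨0,1, c ⟩ c≤k)   = inj₂ (inj₁ (refl , inj₁ refl , c≤k))
  triple-∈C (⟨0,2, c ⟩ c≤k)   = inj₂ (inj₁ (refl , inj₂ refl , c≤k))

  C-triple : ∀ {a b c} → C k a b c → Σ (Triple k) λ e → element e ≡ combination k (a , b , c)
  C-triple {c = c} (inj₁ (inj₁ (refl , refl , c≤k+1)))    = ⟨1,0, c ⟩ (≤k+1⇒≤1+k c≤k+1) , refl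
  C-triple         (inj₁ (inj₂ (refl , refl , refl)))     = ⟨2,0,0⟩ , refl
  C-triple {c = c} (inj₂ (inj₁ (refl , inj₁ refl , c≤k))) = ⟨0,1, c ⟩ c≤k , refl
  C-triple {c = c} (inj₂ (inj₁ (refl , inj₂ refl , c≤k))) = ⟨0,2, c ⟩ c≤k , refl
  C-triple {c = c} (inj₂ (inj₂ (refl , refl , c≤k+1)))    = ⟨0,0, c ⟩ (≤k+1⇒≤1+k c≤k+1) , refl

  elements⇔C : ∀ s → Σ (Triple k) (λ e → element e ≡ s)
    ⇔ Σ ℕ (λ a → Σ ℕ (λ b → Σ ℕ (λ c →
        C k a b c × a * (4 * k + 9) + b * (4 * k + 13) + c * (4 * k + 15) ≡ s)))
  elements⇔C s = mk⇔
    (λ { (e , refl) → let (a , b , c) = coefficients (digits e) in a , b , c , triple-∈C e , refl })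
    (λ { (a , b , c , abc∈C , refl) → C-triple abc∈C })

theorem30 : (k s : ℕ) →
    InApery (gensS k) (4 * k + 7) s
      ⇔ Σ ℕ (λ a → Σ ℕ (λ b → Σ ℕ (λ c →
          C k a b c × a * (4 * k + 9) + b * (4 * k + 13) + c * (4 * k + 15) ≡ s)))
theorem30 k s = elements⇔C s ⇔-∘ apery-criterion element-∈S (⟨0,0, 0 ⟩ z≤n , refl)
                                   (closed-g₁ ∷ closed-g₂ ∷ closed-g₃ ∷ []) element-incongruent s
  where open AperyCriterion (4 * k + 7) {{nonZero-4k+7 {k}}} (element {k})
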